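{- Let $\lambda$ be a partition with exactly two parts. Then $C_\lambda(q,t)=C_\lambda(t,q)$.
   Context: For a vector $\vec{k}=(k_1,\dots,k_n)$ of positive integers, $\lambda(\vec{k})$ is the partition obtained by sorting its entries decreasingly. A $\vec{k}$-Dyck path is a sequence $(a_1,\dots,a_{|\vec{k}|+n})$, $|\vec{k}|=\sum k_i$, obtained by interspersing $|\vec{k}|$ entries $-1$ among $k_1,\dots,k_n$ (in order) so that all partial sums $r_j=a_1+\cdots+a_{j-1}$ are $\ge0$; $\mathcal{D}_{\vec{k}}$ is the set of these. Entries $k_i$ are red arrows, entries $-1$ blue arrows; for the $j$-th arrow $A$, $r(A)=r_j$ and $\dot r(A)=r_{j+1}$ ($0$ for the last arrow); $A<B$ means $A$ is to the left of $B$. $\operatorname{area}(D)=\sum_S r(S)$ over red arrows $S$. A blue arrow $W<S$ sweeps a red arrow $S$ ($W\to S$) if $W$ meets $S$ when translated right along a line of slope $\epsilon$, $0<\epsilon\ll1$; equivalently $r(S)\le r(W)\le\dot r(S)$. $$\operatorname{dinv}(D)=\sum_{W<S}\chi(W\to S)+\sum_{S_i<S_j}\chi\big(r(S_i)\ge r(S_j)\ \&\ \dot r(S_j)>\dot r(S_i)\big)(\dot r(S_j)-\dot r(S_i))+\sum_{S_i<S_j}\chi\big(r(S_i)<r(S_j)\ \&\ \dot r(S_j)<\dot r(S_i)\big)(\dot r(S_i)-\dot r(S_j)),$$ with $W$ blue, $S,S_i,S_j$ red, $\chi$ the indicator function. Define $$C_\lambda(q,t)=\sum_{\vec{k}:\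 \lambda(\vec{k})=\lambda}\ \sum_{D\in\mathcal{D}_{\vec{k}}} q^{\operatorname{dinv}(D)}t^{\operatorname{area}(D)}.$$ -}

module Defs where

open import Data.Nat using (ℕ; zero; suc; _+_; _∸_; _≤ᵇ_; _<ᵇ_; _≡ᵇ_)
open import Data.Bool using (Bool; true; false; if_then_else_; _∧_)
open import Data.List using (List; []; _∷_; map; _++_; concatMap; filter; length; replicate; upTo; mapMaybe)
open import Data.Nat.ListAction using (sum)
open import Data.Maybe using (Maybe; just; nothing)
open import Data.Product using (_×_; _,_)
open import Relation.Nullary.Decidable using (⌊_⌋)
open import Data.List.Properties using (≡-dec)
open import Data.Nat.Properties using (_≟_)
open import Relation.Binary.PropositionalEquality using (_≡_)

-- Arrows of a k-Dyck path: a red arrow carries its entry k_i, a blue arrow is the entry -1.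
data Arrow : Set where
  red  : ℕ → Arrow
  blue : Arrow

step : ℕ → Arrow → Maybe ℕ
step r (red k) = just (r + k)
step zero blue = nothing
step (suc r) blue = just r

-- Annotated arrow: (arrow, r(A), ṙ(A)).
AArrow : Set
AArrow = Arrow × ℕ × ℕ

annotate : ℕ → List Arrow → Maybe (List AArrow)
annotate r [] = just []
annotate r (a ∷ as) with step r a
... | nothing = nothing
... | just r' with annotate r' as
...   | nothing = nothing
...   | just rest = just ((a , r , dot as r') ∷ rest)
  where
  -- ṙ(A) = r_{j+1}, and 0 for the last arrow
  dot : List Arrow → ℕ → ℕ
  dot [] _ = 0
  dot (_ ∷ _) x = x

interleave : List ℕ → ℕ → List (List Arrow)
interleave [] m = replicate m blue ∷ []
interleave (k ∷ ks) zero = map red (k ∷ ks) ∷ []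
interleave (k ∷ ks) (suc m) =
  map (red k ∷_) (interleave ks (suc m)) ++ map (blue ∷_) (interleave (k ∷ ks) m)

dyckPaths : List ℕ → List (List AArrow)
dyckPaths ks = mapMaybe (annotate 0) (interleave ks (sum ks))

area : List AArrow → ℕ
area [] = 0
area ((red _ , r , _) ∷ as) = r + area as
area ((blue , _ , _) ∷ as) = area as

χ : Bool → ℕ
χ true = 1
χ false = 0

pairContrib : AArrow → AArrow → ℕ
pairContrib (blue , rW , _) (red _ , rS , ṙS) = χ ((rS ≤ᵇ rW) ∧ (rW ≤ᵇ ṙS))
pairContrib (red _ , ri , ṙi) (red _ , rj , ṙj) =
  (if (rj ≤ᵇ ri) ∧ (ṙi <ᵇ ṙj) then ṙj ∸ ṙi else 0)
  + (if (ri <ᵇ rj) ∧ (ṙj <ᵇ ṙi) then ṙi ∸ ṙj else 0)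
pairContrib _ _ = 0

dinv : List AArrow → ℕ
dinv [] = 0
dinv (a ∷ as) = sum (map (pairContrib a) as) + dinv as

insertDesc : ℕ → List ℕ → List ℕ
insertDesc x [] = x ∷ []
insertDesc x (y ∷ ys) = if y ≤ᵇ x then x ∷ y ∷ ys else y ∷ insertDesc x ys

sortDesc : List ℕ → List ℕ
sortDesc [] = []
sortDesc (x ∷ xs) = insertDesc x (sortDesc xs)

listsOver : ℕ → ℕ → List (List ℕ)
listsOver zero M = [] ∷ []
listsOver (suc n) M = concatMap (λ x → map (suc x ∷_) (listsOver n M)) (upTo M)

-- all vectors k of positive integers with λ(k) = λ
-- (any such k has entries ≤ |λ|, and length = length λ)
kVectors : List ℕ → List (List ℕ)
kVectors lam = filter (λ k → ≡-dec _≟_ (sortDesc k) lam) (listsOver (length lam) (sum lam))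

-- C_λ(q,t) as the list of its monomials q^dinv t^area (with multiplicity)
Cmonomials : List ℕ → List (ℕ × ℕ)
Cmonomials lam = concatMap (λ k → map (λ D → (dinv D , area D)) (dyckPaths k)) (kVectors lam)

coeff : List (ℕ × ℕ) → ℕ → ℕ → ℕ
coeff [] i j = 0
coeff ((a , b) ∷ ms) i j = χ ((a ≡ᵇ i) ∧ (b ≡ᵇ j)) + coeff ms i j

-- For k = (p, q) a k-Dyck path starts with the red arrow p, then has x ≤ p blue
-- arrows before the red arrow q, and descends to 0 afterwards. Its area is p − x.
-- The x blue arrows sweep q exactly min(x, q) times, and the two red arrows add
-- x − q when x < p and q − p when x = p, so dinv = x for x < p and dinv = q for x = p.
-- Hence the paths of (p, q) contribute Σ_{x<p} q^x t^(p−x) + q^q, and together with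
-- those of (q, p) they give the two full antidiagonals Σ_{i+j=p} q^i t^j + Σ_{i+j=q} q^i t^j,
-- which are symmetric in q and t. Since λ(p, q) = λ(q, p), summing the coefficients
-- of C_λ over all ordered pairs (p, q) twice, once transposed, shows 2 C_λ(q,t) = 2 C_λ(t,q).
module Submission where

open import Level using (Level)
open import Data.Bool using (Bool; true; false; if_then_else_; _∧_)
open import Data.Empty using (⊥-elim)
open import Data.Fin using (Fin; toℕ)
open import Data.List using (List; []; _∷_; _++_; _∷ʳ_; map; concatMap; filter; replicate; applyUpTo; upTo; mapMaybe)
open import Data.List.Properties
  using (map-++; ++-identityʳ; map-applyUpTo; applyUpTo-∷ʳ; mapMaybe-++; mapMaybe-map-none; concatMap-++; concatMap-map; ≡-dec)
open import Data.Maybe using (Maybe; just; nothing)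
open import Data.Nat using (ℕ; zero; suc; _+_; _*_; _∸_; _⊓_; _≤_; _<_; _≤ᵇ_; _<ᵇ_; _≡ᵇ_; z≤n; s≤s; z<s; NonZero)
open import Data.Nat.ListAction using (sum)
open import Data.Nat.ListAction.Properties using (sum-++)
open import Data.Nat.Properties
open import Data.Nat.Tactic.RingSolver using (solve-∀)
open import Data.Product using (_×_; _,_; map₁)
open import Data.Sum using ([_,_]′)
open import Relation.Binary.PropositionalEquality
open import Relation.Nullary using (does)
open import Relation.Nullary.Reflects using (ofʸ; ofⁿ)
open import Relation.Unary using (Pred; Decidable)

open import Defs
open import Algebra.Properties.CommutativeMonoid.Sum +-0-commutativeMonoid
  using (sum-syntax; ∑-comm; ∑-distrib-+; sum-cong-≗)

private variable
  A B C : Set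
  ℓ : Level

applyUpTo-cong< : ∀ {f g : ℕ → A} n → (∀ {x} → x < n → f x ≡ g x) → applyUpTo f n ≡ applyUpTo g n
applyUpTo-cong< zero _ = refl
applyUpTo-cong< (suc n) f≡g = cong₂ _∷_ (f≡g z<s) (applyUpTo-cong< n (λ x<n → f≡g (s≤s x<n)))

mapMaybe-applyUpTo : ∀ (f : A → Maybe B) (g : ℕ → A) (h : ℕ → B) m n → m ≤ n →
  (∀ {x} → x < m → f (g x) ≡ just (h x)) → (∀ {x} → m ≤ x → f (g x) ≡ nothing) →
  mapMaybe f (applyUpTo g n) ≡ applyUpTo h m
mapMaybe-applyUpTo f g h zero zero _ _ _ = refl
mapMaybe-applyUpTo f g h zero (suc n) _ _ none rewrite none {0} z≤n =
  mapMaybe-applyUpTo f (λ x → g (suc x)) h zero n z≤n (λ ()) (λ _ → none z≤n)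
mapMaybe-applyUpTo f g h (suc m) (suc n) (s≤s m≤n) some none rewrite some {0} z<s =
  cong (h 0 ∷_) (mapMaybe-applyUpTo f (λ x → g (suc x)) (λ x → h (suc x)) m n m≤n
    (λ x<m → some (s≤s x<m)) (λ m≤x → none (s≤s m≤x)))

concatMap-filter : ∀ {P : Pred A ℓ} (P? : Decidable P) (f : A → List B) xs →
  concatMap f (filter P? xs) ≡ concatMap (λ x → if does (P? x) then f x else []) xs
concatMap-filter P? f [] = refl
concatMap-filter P? f (x ∷ xs) with does (P? x)
... | true  = cong (f x ++_) (concatMap-filter P? f xs)
... | false = concatMap-filter P? f xs

concatMap-concatMap : ∀ (f : B → List C) (g : A → List B) xs →
  concatMap f (concatMap g xs) ≡ concatMap (λ x → concatMap f (g x)) xs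
concatMap-concatMap f g [] = refl
concatMap-concatMap f g (x ∷ xs) =
  trans (concatMap-++ f (g x) (concatMap g xs)) (cong (concatMap f (g x) ++_) (concatMap-concatMap f g xs))

≤ᵇ-true : ∀ {m n} → m ≤ n → (m ≤ᵇ n) ≡ true
≤ᵇ-true {m} {n} m≤n with m ≤ᵇ n | ≤⇒≤ᵇ m≤n
... | true | _ = refl

+-cancelˡ-<ᵇ : ∀ s m n → (s + m <ᵇ s + n) ≡ (m <ᵇ n)
+-cancelˡ-<ᵇ zero m n = refl
+-cancelˡ-<ᵇ (suc s) m n = +-cancelˡ-<ᵇ s m n

if-<ᵇ-∸ : ∀ m n → (if m <ᵇ n then n ∸ m else 0) ≡ n ∸ m
if-<ᵇ-∸ m n with m <ᵇ n | <ᵇ-reflects-< m n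
... | true  | _ = refl
... | false | ofⁿ m≮n = sym (m≤n⇒m∸n≡0 (≮⇒≥ m≮n))

χ-<ᵇ+⊓ : ∀ x q → χ (x <ᵇ q) + x ⊓ q ≡ suc x ⊓ q
χ-<ᵇ+⊓ x q with x <ᵇ q | <ᵇ-reflects-< x q
... | true  | ofʸ x<q  rewrite m≤n⇒m⊓n≡m (<⇒≤ x<q) | m≤n⇒m⊓n≡m x<q = refl
... | false | ofⁿ x≮q rewrite m≥n⇒m⊓n≡n (≮⇒≥ x≮q) | m≥n⇒m⊓n≡n (m≤n⇒m≤1+n (≮⇒≥ x≮q)) = refl

∑∑-symmetrise : ∀ {n} (f g : Fin n → Fin n → ℕ) → (∀ x y → f x y + f y x ≡ g x y + g y x) →
  ∑[ x < n ] ∑[ y < n ] f x y ≡ ∑[ x < n ] ∑[ y < n ] g x y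
∑∑-symmetrise {n} f g f+fᵀ≡g+gᵀ =
  *-cancelˡ-≡ _ _ 2 (trans (twice f) (trans (sum-cong-≗ λ x → sum-cong-≗ λ y → f+fᵀ≡g+gᵀ x y) (sym (twice g))))
  where
  twice : ∀ h → 2 * ∑[ x < n ] ∑[ y < n ] h x y ≡ ∑[ x < n ] ∑[ y < n ] (h x y + h y x)
  twice h = begin
    2 * ∑[ x < n ] ∑[ y < n ] h x y
      ≡⟨ cong (∑[ x < n ] ∑[ y < n ] h x y +_) (+-identityʳ _) ⟩
    ∑[ x < n ] ∑[ y < n ] h x y + ∑[ x < n ] ∑[ y < n ] h x y
      ≡⟨ cong (∑[ x < n ] ∑[ y < n ] h x y +_) (∑-comm h) ⟩
    ∑[ x < n ] ∑[ y < n ] h x y + ∑[ x < n ] ∑[ y < n ] h y x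
      ≡⟨ sym (∑-distrib-+ (λ x → ∑[ y < n ] h x y) (λ x → ∑[ y < n ] h y x)) ⟩
    ∑[ x < n ] (∑[ y < n ] h x y + ∑[ y < n ] h y x)
      ≡⟨ sum-cong-≗ (λ x → sym (∑-distrib-+ (h x) (λ y → h y x))) ⟩
    ∑[ x < n ] ∑[ y < n ] (h x y + h y x) ∎
    where open ≡-Reasoning

coeff-++ : ∀ ms ms′ i j → coeff (ms ++ ms′) i j ≡ coeff ms i j + coeff ms′ i j
coeff-++ [] ms′ i j = refl
coeff-++ ((a , b) ∷ ms) ms′ i j rewrite coeff-++ ms ms′ i j = sym (+-assoc (χ ((a ≡ᵇ i) ∧ (b ≡ᵇ j))) _ _)

coeff-exchange-last : ∀ ms ms′ u v i j →
  coeff (ms ∷ʳ u) i j + coeff (ms′ ∷ʳ v) i j ≡ coeff (ms ∷ʳ v) i j + coeff (ms′ ∷ʳ u) i j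
coeff-exchange-last ms ms′ u v i j
  rewrite coeff-++ ms (u ∷ []) i j | coeff-++ ms′ (v ∷ []) i j | coeff-++ ms (v ∷ []) i j | coeff-++ ms′ (u ∷ []) i j =
  exchange (coeff ms i j) (coeff (u ∷ []) i j) (coeff ms′ i j) (coeff (v ∷ []) i j)
  where
  exchange : ∀ a u b v → (a + u) + (b + v) ≡ (a + v) + (b + u)
  exchange = solve-∀

coeff-map-suc₁-zero : ∀ ms j → coeff (map (map₁ suc) ms) zero j ≡ 0
coeff-map-suc₁-zero [] j = refl
coeff-map-suc₁-zero (_ ∷ ms) j = coeff-map-suc₁-zero ms j

coeff-map-suc₁-suc : ∀ ms i j → coeff (map (map₁ suc) ms) (suc i) j ≡ coeff ms i j
coeff-map-suc₁-suc [] i j = refl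
coeff-map-suc₁-suc (_ ∷ ms) i j = cong (_ +_) (coeff-map-suc₁-suc ms i j)

coeff-concatMap-applyUpTo : ∀ (f : A → List (ℕ × ℕ)) g n i j →
  coeff (concatMap f (applyUpTo g n)) i j ≡ ∑[ x < n ] coeff (f (g (toℕ x))) i j
coeff-concatMap-applyUpTo f g zero i j = refl
coeff-concatMap-applyUpTo f g (suc n) i j =
  trans (coeff-++ (f (g 0)) (concatMap f (applyUpTo (λ x → g (suc x)) n)) i j)
        (cong (coeff (f (g 0)) i j +_) (coeff-concatMap-applyUpTo f (λ x → g (suc x)) n i j))

coeff-concatMap-listsOver-suc : ∀ (f : List ℕ → List (ℕ × ℕ)) n M i j →
  coeff (concatMap f (listsOver (suc n) M)) i j
    ≡ ∑[ x < M ] coeff (concatMap (λ k → f (suc (toℕ x) ∷ k)) (listsOver n M)) i j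
coeff-concatMap-listsOver-suc f n M i j = begin
  coeff (concatMap f (listsOver (suc n) M)) i j
    ≡⟨ cong (λ ms → coeff ms i j) (concatMap-concatMap f (λ x → map (suc x ∷_) (listsOver n M)) (upTo M)) ⟩
  coeff (concatMap (λ x → concatMap f (map (suc x ∷_) (listsOver n M))) (upTo M)) i j
    ≡⟨ coeff-concatMap-applyUpTo (λ x → concatMap f (map (suc x ∷_) (listsOver n M))) (λ x → x) M i j ⟩
  ∑[ x < M ] coeff (concatMap f (map (suc (toℕ x) ∷_) (listsOver n M))) i j
    ≡⟨ sum-cong-≗ {M} (λ x → cong (λ ms → coeff ms i j) (concatMap-map f (suc (toℕ x) ∷_) (listsOver n M))) ⟩
  ∑[ x < M ] coeff (concatMap (λ k → f (suc (toℕ x) ∷ k)) (listsOver n M)) i j ∎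
  where open ≡-Reasoning

coeff-concatMap-listsOver-2 : ∀ (f : List ℕ → List (ℕ × ℕ)) M i j →
  coeff (concatMap f (listsOver 2 M)) i j ≡ ∑[ x < M ] ∑[ y < M ] coeff (f (suc (toℕ x) ∷ suc (toℕ y) ∷ [])) i j
coeff-concatMap-listsOver-2 f M i j =
  trans (coeff-concatMap-listsOver-suc f 1 M i j) (sum-cong-≗ {M} λ x →
  trans (coeff-concatMap-listsOver-suc (λ k → f (suc (toℕ x) ∷ k)) 0 M i j) (sum-cong-≗ {M} λ y →
  cong (λ ms → coeff ms i j) (++-identityʳ (f (suc (toℕ x) ∷ suc (toℕ y) ∷ [])))))

antidiagonal : ℕ → List (ℕ × ℕ)
antidiagonal n = applyUpTo (λ x → x , n ∸ x) (suc n)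

antidiagonal-∷ʳ : ∀ n → antidiagonal n ≡ applyUpTo (λ x → x , n ∸ x) n ∷ʳ (n , 0)
antidiagonal-∷ʳ n = trans (sym (applyUpTo-∷ʳ (λ x → x , n ∸ x) n))
  (cong (λ d → applyUpTo (λ x → x , n ∸ x) n ∷ʳ (n , d)) (n∸n≡0 n))

coeff-antidiagonal : ∀ n i j → coeff (antidiagonal n) i j ≡ χ (n ≡ᵇ i + j)
coeff-antidiagonal zero zero j = +-identityʳ _
coeff-antidiagonal zero (suc i) j = refl
coeff-antidiagonal (suc n) i j =
  trans (cong (λ ms → coeff ((0 , suc n) ∷ ms) i j) (sym (map-applyUpTo (λ x → x , n ∸ x) (map₁ suc) (suc n))))
        (shifted i)
  where
  shifted : ∀ i → coeff ((0 , suc n) ∷ map (map₁ suc) (antidiagonal n)) i j ≡ χ (suc n ≡ᵇ i + j)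
  shifted zero rewrite coeff-map-suc₁-zero (antidiagonal n) j = +-identityʳ _
  shifted (suc i) = trans (coeff-map-suc₁-suc (antidiagonal n) i j) (coeff-antidiagonal n i j)

coeff-antidiagonal-comm : ∀ n i j → coeff (antidiagonal n) i j ≡ coeff (antidiagonal n) j i
coeff-antidiagonal-comm n i j rewrite coeff-antidiagonal n i j | coeff-antidiagonal n j i | +-comm i j = refl

-- The Dyck paths of a two-part vector

bluesRedBlues : ℕ → ℕ → ℕ → List Arrow
bluesRedBlues x q m = replicate x blue ++ red q ∷ replicate m blue

interleave-singleton : ∀ q m → interleave (q ∷ []) m ≡ applyUpTo (λ x → bluesRedBlues x q (m ∸ x)) (suc m)
interleave-singleton q zero = refl
interleave-singleton q (suc m) = cong ((red q ∷ replicate (suc m) blue) ∷_) (begin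
  map (blue ∷_) (interleave (q ∷ []) m)
    ≡⟨ cong (map (blue ∷_)) (interleave-singleton q m) ⟩
  map (blue ∷_) (applyUpTo (λ x → bluesRedBlues x q (m ∸ x)) (suc m))
    ≡⟨ map-applyUpTo (λ x → bluesRedBlues x q (m ∸ x)) (blue ∷_) (suc m) ⟩
  applyUpTo (λ x → bluesRedBlues (suc x) q (m ∸ x)) (suc m) ∎)
  where open ≡-Reasoning

descent : ℕ → ℕ → List AArrow
descent zero s = []
descent (suc x) s = (blue , suc (s + x) , s + x) ∷ descent x s

-- For p = s + x: x blue arrows separate the red arrows p and q, and q starts at height s.
twoRedPath : ℕ → ℕ → ℕ → List AArrow
twoRedPath x s q = (red (s + x) , 0 , s + x) ∷ descent x s ++ (red q , s , s + q) ∷ descent (s + q) 0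

annotate-landing : ∀ n → annotate n (replicate n blue) ≡ just (descent n 0)
annotate-landing zero = refl
annotate-landing (suc zero) = refl
annotate-landing (suc (suc n)) rewrite annotate-landing (suc n) = refl

annotate-descent : ∀ x s b bs {R} → annotate s (b ∷ bs) ≡ just R →
  annotate (s + x) (replicate x blue ++ b ∷ bs) ≡ just (descent x s ++ R)
annotate-descent zero s b bs eq rewrite +-identityʳ s = eq
annotate-descent (suc zero) s b bs eq rewrite +-suc s 0 | +-identityʳ s | eq = refl
annotate-descent (suc (suc x)) s b bs eq with annotate-descent (suc x) s b bs eq
... | ih rewrite +-suc s (suc x) | ih = refl

annotate-red-landing : ∀ s q .{{_ : NonZero q}} →
  annotate s (red q ∷ replicate (s + q) blue) ≡ just ((red q , s , s + q) ∷ descent (s + q) 0)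
annotate-red-landing s (suc q) rewrite +-suc s q | annotate-landing (suc (s + q)) = refl

annotate-underflow : ∀ {r x} L → r < x → annotate r (replicate x blue ++ L) ≡ nothing
annotate-underflow {zero} {suc x} L _ = refl
annotate-underflow {suc r} {suc x} L (s≤s r<x) rewrite annotate-underflow L r<x = refl

annotate-twoRedPath : ∀ x s q .{{_ : NonZero q}} →
  annotate 0 (red (s + x) ∷ bluesRedBlues x q (s + q)) ≡ just (twoRedPath x s q)
annotate-twoRedPath zero s q rewrite annotate-descent 0 s (red q) _ (annotate-red-landing s q) = refl
annotate-twoRedPath (suc x) s q rewrite annotate-descent (suc x) s (red q) _ (annotate-red-landing s q) = refl

annotate-pair-valid : ∀ p q .{{_ : NonZero q}} {x} → x ≤ p →
  annotate 0 (red p ∷ bluesRedBlues x q (p + q ∸ x)) ≡ just (twoRedPath x (p ∸ x) q)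
annotate-pair-valid p q {x} x≤p = begin
  annotate 0 (red p ∷ bluesRedBlues x q (p + q ∸ x))
    ≡⟨ cong₂ (λ p′ m → annotate 0 (red p′ ∷ bluesRedBlues x q m)) (sym (m∸n+n≡m x≤p)) (+-∸-comm q x≤p) ⟩
  annotate 0 (red (p ∸ x + x) ∷ bluesRedBlues x q (p ∸ x + q))
    ≡⟨ annotate-twoRedPath x (p ∸ x) q ⟩
  just (twoRedPath x (p ∸ x) q) ∎
  where open ≡-Reasoning

annotate-pair-invalid : ∀ p q m {x} → p < x → annotate 0 (red p ∷ bluesRedBlues x q m) ≡ nothing
annotate-pair-invalid p q m p<x rewrite annotate-underflow (red q ∷ replicate m blue) p<x = refl

dyckPaths-pair : ∀ p q .{{_ : NonZero p}} .{{_ : NonZero q}} →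
  dyckPaths (p ∷ q ∷ []) ≡ applyUpTo (λ x → twoRedPath x (p ∸ x) q) (suc p)
dyckPaths-pair p@(suc p′) q = begin
  mapMaybe (annotate 0) (map (red p ∷_) (interleave (q ∷ []) n) ++ map (blue ∷_) startsBlue)
    ≡⟨ mapMaybe-++ (annotate 0) (map (red p ∷_) (interleave (q ∷ []) n)) (map (blue ∷_) startsBlue) ⟩
  startsRed ++ mapMaybe (annotate 0) (map (blue ∷_) startsBlue)
    ≡⟨ cong (startsRed ++_) (mapMaybe-map-none (λ _ → refl) startsBlue) ⟩
  startsRed ++ []
    ≡⟨ ++-identityʳ startsRed ⟩
  mapMaybe (annotate 0) (map (red p ∷_) (interleave (q ∷ []) n))
    ≡⟨ cong (λ ws → mapMaybe (annotate 0) (map (red p ∷_) ws)) (interleave-singleton q n) ⟩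
  mapMaybe (annotate 0) (map (red p ∷_) (applyUpTo (λ x → bluesRedBlues x q (n ∸ x)) (suc n)))
    ≡⟨ cong (mapMaybe (annotate 0)) (map-applyUpTo (λ x → bluesRedBlues x q (n ∸ x)) (red p ∷_) (suc n)) ⟩
  mapMaybe (annotate 0) (applyUpTo (λ x → red p ∷ bluesRedBlues x q (n ∸ x)) (suc n))
    ≡⟨ mapMaybe-applyUpTo (annotate 0) (λ x → red p ∷ bluesRedBlues x q (n ∸ x)) (λ x → twoRedPath x (p ∸ x) q)
         (suc p) (suc n) (s≤s (m≤m+n p (q + 0))) valid (λ {x} p<x → annotate-pair-invalid p q (n ∸ x) p<x) ⟩
  applyUpTo (λ x → twoRedPath x (p ∸ x) q) (suc p) ∎
  where
  open ≡-Reasoning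
  n = p + (q + 0)
  startsBlue = interleave (p ∷ q ∷ []) (p′ + (q + 0))
  startsRed = mapMaybe (annotate 0) (map (red p ∷_) (interleave (q ∷ []) n))
  valid : ∀ {x} → x < suc p → annotate 0 (red p ∷ bluesRedBlues x q (n ∸ x)) ≡ just (twoRedPath x (p ∸ x) q)
  valid (s≤s x≤p) rewrite +-identityʳ q = annotate-pair-valid p q x≤p

-- dinv and area of the two-red-arrow paths

pairContrib-blue : ∀ a r r′ → pairContrib a (blue , r , r′) ≡ 0
pairContrib-blue (red _ , _ , _) r r′ = refl
pairContrib-blue (blue , _ , _) r r′ = refl

sum-pairContrib-descent : ∀ a x s → sum (map (pairContrib a) (descent x s)) ≡ 0
sum-pairContrib-descent a zero s = refl
sum-pairContrib-descent a (suc x) s rewrite pairContrib-blue a (suc (s + x)) (s + x) = sum-pairContrib-descent a x s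

sum-pairContrib-descent-++ : ∀ a x s L → sum (map (pairContrib a) (descent x s ++ L)) ≡ sum (map (pairContrib a) L)
sum-pairContrib-descent-++ a x s L
  rewrite map-++ (pairContrib a) (descent x s) L
        | sum-++ (map (pairContrib a) (descent x s)) (map (pairContrib a) L)
        | sum-pairContrib-descent a x s = refl

dinv-descent : ∀ x s → dinv (descent x s) ≡ 0
dinv-descent zero s = refl
dinv-descent (suc x) s rewrite sum-pairContrib-descent (blue , suc (s + x) , s + x) x s = dinv-descent x s

area-descent : ∀ x s → area (descent x s) ≡ 0
area-descent zero s = refl
area-descent (suc x) s = area-descent x s

area-descent-++ : ∀ x s L → area (descent x s ++ L) ≡ area L
area-descent-++ zero s L = refl
area-descent-++ (suc x) s L = area-descent-++ x s L

-- The blue arrow at height s + 1 + y sweeps the red arrow q at height s iff y < q.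
dinv-sweeps : ∀ x s q n t → dinv (descent x s ++ (red q , s , s + q) ∷ descent n t) ≡ x ⊓ q
dinv-sweeps zero s q n t
  rewrite sum-pairContrib-descent (red q , s , s + q) n t | dinv-descent n t = refl
dinv-sweeps (suc x) s q n t
  rewrite sum-pairContrib-descent-++ (blue , suc (s + x) , s + x) x s ((red q , s , s + q) ∷ descent n t)
        | sum-pairContrib-descent (blue , suc (s + x) , s + x) n t
        | ≤ᵇ-true (m≤n⇒m≤1+n (m≤m+n s x))
        | +-cancelˡ-<ᵇ s x q
        | +-identityʳ (χ (x <ᵇ q))
        | dinv-sweeps x s q n t = χ-<ᵇ+⊓ x q

dinv-twoRedPath : ∀ x s q →
  dinv (twoRedPath x s q) ≡ pairContrib (red (s + x) , 0 , s + x) (red q , s , s + q) + x ⊓ q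
dinv-twoRedPath x s q
  rewrite sum-pairContrib-descent-++ (red (s + x) , 0 , s + x) x s ((red q , s , s + q) ∷ descent (s + q) 0)
        | sum-pairContrib-descent (red (s + x) , 0 , s + x) (s + q) 0
        | dinv-sweeps x s q (s + q) 0 = cong (_+ x ⊓ q) (+-identityʳ _)

dinv-twoRedPath-grounded : ∀ x q → dinv (twoRedPath x 0 q) ≡ q
dinv-twoRedPath-grounded x q
  rewrite dinv-twoRedPath x 0 q | if-<ᵇ-∸ x q | +-identityʳ (q ∸ x) =
  trans (+-comm (q ∸ x) (x ⊓ q)) (m⊓n+n∸m≡n x q)

dinv-twoRedPath-raised : ∀ x s q → dinv (twoRedPath x (suc s) q) ≡ x
dinv-twoRedPath-raised x s q
  rewrite dinv-twoRedPath x (suc s) q | if-<ᵇ-∸ (s + q) (s + x) | [m+n]∸[m+o]≡n∸o s x q | ⊓-comm x q =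
  trans (+-comm (x ∸ q) (q ⊓ x)) (m⊓n+n∸m≡n q x)

area-twoRedPath : ∀ x s q → area (twoRedPath x s q) ≡ s
area-twoRedPath x s q
  rewrite area-descent-++ x s ((red q , s , s + q) ∷ descent (s + q) 0) | area-descent (s + q) 0 = +-identityʳ s

monomial : List AArrow → ℕ × ℕ
monomial D = dinv D , area D

monomials : List ℕ → List (ℕ × ℕ)
monomials k = map monomial (dyckPaths k)

monomials-pair : ∀ p q .{{_ : NonZero p}} .{{_ : NonZero q}} →
  monomials (p ∷ q ∷ []) ≡ applyUpTo (λ x → x , p ∸ x) p ∷ʳ (q , 0)
monomials-pair p q = begin
  map monomial (dyckPaths (p ∷ q ∷ []))
    ≡⟨ cong (map monomial) (dyckPaths-pair p q) ⟩
  map monomial (applyUpTo path (suc p))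
    ≡⟨ map-applyUpTo path monomial (suc p) ⟩
  applyUpTo (λ x → monomial (path x)) (suc p)
    ≡⟨ sym (applyUpTo-∷ʳ (λ x → monomial (path x)) p) ⟩
  applyUpTo (λ x → monomial (path x)) p ∷ʳ monomial (path p)
    ≡⟨ cong₂ _∷ʳ_ (applyUpTo-cong< p raised) grounded ⟩
  applyUpTo (λ x → x , p ∸ x) p ∷ʳ (q , 0) ∎
  where
  open ≡-Reasoning
  path : ℕ → List AArrow
  path x = twoRedPath x (p ∸ x) q
  raised : ∀ {x} → x < p → monomial (path x) ≡ (x , p ∸ x)
  raised {x} x<p with p ∸ x | m<n⇒0<n∸m x<p
  ... | suc s | _ = cong₂ _,_ (dinv-twoRedPath-raised x s q) (area-twoRedPath x (suc s) q)
  grounded : monomial (path p) ≡ (q , 0)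
  grounded rewrite n∸n≡0 p = cong₂ _,_ (dinv-twoRedPath-grounded p q) (area-twoRedPath p 0 q)

coeff-monomials-pair : ∀ p q .{{_ : NonZero p}} .{{_ : NonZero q}} i j →
  coeff (monomials (p ∷ q ∷ [])) i j + coeff (monomials (q ∷ p ∷ [])) i j
    ≡ coeff (antidiagonal p) i j + coeff (antidiagonal q) i j
coeff-monomials-pair p q i j = begin
  coeff (monomials (p ∷ q ∷ [])) i j + coeff (monomials (q ∷ p ∷ [])) i j
    ≡⟨ cong₂ (λ ms ms′ → coeff ms i j + coeff ms′ i j) (monomials-pair p q) (monomials-pair q p) ⟩
  coeff (below p ∷ʳ (q , 0)) i j + coeff (below q ∷ʳ (p , 0)) i j
    ≡⟨ coeff-exchange-last (below p) (below q) (q , 0) (p , 0) i j ⟩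
  coeff (below p ∷ʳ (p , 0)) i j + coeff (below q ∷ʳ (q , 0)) i j
    ≡⟨ sym (cong₂ (λ ms ms′ → coeff ms i j + coeff ms′ i j) (antidiagonal-∷ʳ p) (antidiagonal-∷ʳ q)) ⟩
  coeff (antidiagonal p) i j + coeff (antidiagonal q) i j ∎
  where
  open ≡-Reasoning
  below : ℕ → List (ℕ × ℕ)
  below n = applyUpTo (λ x → x , n ∸ x) n

coeff-monomials-pair-comm : ∀ p q .{{_ : NonZero p}} .{{_ : NonZero q}} i j →
  coeff (monomials (p ∷ q ∷ [])) i j + coeff (monomials (q ∷ p ∷ [])) i j
    ≡ coeff (monomials (p ∷ q ∷ [])) j i + coeff (monomials (q ∷ p ∷ [])) j i
coeff-monomials-pair-comm p q i j = begin
  coeff (monomials (p ∷ q ∷ [])) i j + coeff (monomials (q ∷ p ∷ [])) i j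
    ≡⟨ coeff-monomials-pair p q i j ⟩
  coeff (antidiagonal p) i j + coeff (antidiagonal q) i j
    ≡⟨ cong₂ _+_ (coeff-antidiagonal-comm p i j) (coeff-antidiagonal-comm q i j) ⟩
  coeff (antidiagonal p) j i + coeff (antidiagonal q) j i
    ≡⟨ sym (coeff-monomials-pair p q j i) ⟩
  coeff (monomials (p ∷ q ∷ [])) j i + coeff (monomials (q ∷ p ∷ [])) j i ∎
  where open ≡-Reasoning

sortDesc-pair-comm : ∀ p q → sortDesc (p ∷ q ∷ []) ≡ sortDesc (q ∷ p ∷ [])
sortDesc-pair-comm p q with q ≤ᵇ p | ≤ᵇ⇒≤ q p | ≤⇒≤ᵇ {q} {p} | p ≤ᵇ q | ≤ᵇ⇒≤ p q | ≤⇒≤ᵇ {p} {q}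
... | true  | q≤p | _   | true  | p≤q | _   rewrite ≤-antisym (p≤q _) (q≤p _) = refl
... | true  | _   | _   | false | _   | _   = refl
... | false | _   | _   | true  | _   | _   = refl
... | false | _   | q≰p | false | _   | p≰q = ⊥-elim ([ p≰q , q≰p ]′ (≤-total p q))

hasShape : List ℕ → List ℕ → Bool
hasShape lam k = does (≡-dec _≟_ (sortDesc k) lam)

monomialsOfShape : List ℕ → List ℕ → List (ℕ × ℕ)
monomialsOfShape lam k = if hasShape lam k then monomials k else []

coeff-monomialsOfShape-pair-comm : ∀ lam p q .{{_ : NonZero p}} .{{_ : NonZero q}} i j →
  coeff (monomialsOfShape lam (p ∷ q ∷ [])) i j + coeff (monomialsOfShape lam (q ∷ p ∷ [])) i j
    ≡ coeff (monomialsOfShape lam (p ∷ q ∷ [])) j i + coeff (monomialsOfShape lam (q ∷ p ∷ [])) j i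
coeff-monomialsOfShape-pair-comm lam p q i j =
  restrict (hasShape lam (p ∷ q ∷ [])) (hasShape lam (q ∷ p ∷ []))
    (cong (λ k → does (≡-dec _≟_ k lam)) (sortDesc-pair-comm p q))
  where
  restrict : ∀ b b′ → b ≡ b′ →
    coeff (if b then monomials (p ∷ q ∷ []) else []) i j + coeff (if b′ then monomials (q ∷ p ∷ []) else []) i j
      ≡ coeff (if b then monomials (p ∷ q ∷ []) else []) j i + coeff (if b′ then monomials (q ∷ p ∷ []) else []) j i
  restrict true  .true  refl = coeff-monomials-pair-comm p q i j
  restrict false .false refl = refl

coeff-Cmonomials-pair : ∀ a b i j → let M = a + (b + 0) in
  coeff (Cmonomials (a ∷ b ∷ [])) i j
    ≡ ∑[ x < M ] ∑[ y < M ] coeff (monomialsOfShape (a ∷ b ∷ []) (suc (toℕ x) ∷ suc (toℕ y) ∷ [])) i j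
coeff-Cmonomials-pair a b i j =
  trans (cong (λ ms → coeff ms i j) (concatMap-filter (λ k → ≡-dec _≟_ (sortDesc k) lam) monomials (listsOver 2 M)))
        (coeff-concatMap-listsOver-2 (monomialsOfShape lam) M i j)
  where
  lam = a ∷ b ∷ []
  M = a + (b + 0)

mainTheorem5 : (a b : ℕ) → 1 ≤ b → b ≤ a →
    (i j : ℕ) → coeff (Cmonomials (a ∷ b ∷ [])) i j ≡ coeff (Cmonomials (a ∷ b ∷ [])) j i
mainTheorem5 a b _ _ i j = begin
  coeff (Cmonomials (a ∷ b ∷ [])) i j  ≡⟨ coeff-Cmonomials-pair a b i j ⟩
  ∑[ x < M ] ∑[ y < M ] c i j x y       ≡⟨ ∑∑-symmetrise (c i j) (c j i) c-pair-comm ⟩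
  ∑[ x < M ] ∑[ y < M ] c j i x y       ≡⟨ sym (coeff-Cmonomials-pair a b j i) ⟩
  coeff (Cmonomials (a ∷ b ∷ [])) j i  ∎
  where
  open ≡-Reasoning
  M = a + (b + 0)
  c : ℕ → ℕ → Fin M → Fin M → ℕ
  c i j x y = coeff (monomialsOfShape (a ∷ b ∷ []) (suc (toℕ x) ∷ suc (toℕ y) ∷ [])) i j
  c-pair-comm : ∀ x y → c i j x y + c i j y x ≡ c j i x y + c j i y x
  c-pair-comm x y = coeff-monomialsOfShape-pair-comm (a ∷ b ∷ []) (suc (toℕ x)) (suc (toℕ y)) i j
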